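{- Let $p$ be a $1\bmod 4$ prime. If two $p$-clock sums are distinct and their respective lengths $L$ and $M$ both satisfy $L\le \frac{p-1}{2}$ and $M\le\frac{p-1}{2}$, then these two $p$-clock sums are not equal as elements of $\Omega_2$.
   Context: $\mathbb{N}=\{0,1,2,\dots\}$. For a prime $p$ and integer $0\le t\le p-1$, the prime clock $[p,t]:\mathbb{N}\to\mathbb{N}$ is $[p,t](m)=(m+t)\bmod p$. $\Omega_2$ is the set of functions $\mathbb{N}\to\{0,1\}$; the sum $[p,t_1]\oplus\cdots\oplus[p,t_l]\in\Omega_2$ is $m\mapsto\big(\sum_{i=1}^l[p,t_i](m)\big)\bmod 2$. A $p$-clock sum of length $l$ is such a sum with $t_1,\dots,t_l\in\{0,\dots,p-1\}$ pairwise distinct. Two $p$-clock sums $[p,s_1]\oplus\cdots\oplus[p,s_L]$ and $[p,t_1]\oplus\cdots\oplus[p,t_M]$ are distinct if the sets $\{s_1,\dots,s_L\}$ and $\{t_1,\dots,t_M\}$ differ. An odd prime $p$ is a $1\bmod 4$ prime if $(p-1)/2$ is even. -}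

module Defs where

open import Data.Nat using (ℕ; _+_; _%_; _∸_; _/_; _<_; NonZero)
open import Data.Nat.Primality using (Prime)
open import Data.List using (List; map)
open import Data.Nat.ListAction using (sum)
open import Data.Product using (_×_)
open import Relation.Binary.PropositionalEquality using (_≡_)

clock : (p : ℕ) → .{{NonZero p}} → ℕ → ℕ → ℕ
clock p t m = (m + t) % p

-- the sum [p,t₁] ⊕ ⋯ ⊕ [p,tₗ] ∈ Ω₂ : m ↦ (Σ [p,tᵢ](m)) mod 2
clockSum : (p : ℕ) → .{{NonZero p}} → List ℕ → ℕ → ℕ
clockSum p ts m = sum (map (λ t → clock p t m) ts) % 2

OneMod4Prime : ℕ → Set
OneMod4Prime p = Prime p × (p % 2 ≡ 1) × (((p ∸ 1) / 2) % 2 ≡ 0)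

-- Let T(m) be the sum of the clock values at time m. From m to m + 1 every clock
-- advances by one, except the W(m) clocks showing p - 1, which drop to 0; as p is
-- odd, T(m + 1) ≡ T(m) + L + W(m) (mod 2) for a sum of length L. At a time at which
-- only the clock c shows p - 1, W(m) is the indicator of c. So if two clock sums
-- agree, [c ∈ s] + L ≡ [c ∈ t] + M (mod 2) for every c < p: if L ≡ M the two sets
-- coincide, and otherwise every c < p lies in one of them, forcing L + M ≥ p.
module Submission where

open import Defs
open import Data.Nat using (ℕ; suc; _+_; _*_; _%_; _/_; _∸_; _<_; _≤_; _≟_; s≤s; NonZero; parity)
open import Data.List using (List; []; _∷_; _++_; length; map; filter; lookup)
open import Data.List.Relation.Unary.All using (All)
open import Data.List.Relation.Unary.Unique.Propositional using (Unique)
open import Data.List.Membership.Propositional using (_∈_)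
open import Data.Product using (_×_; _,_; ∃₂)
open import Relation.Nullary using (¬_; Dec; yes; no; contradiction)
open import Relation.Binary.PropositionalEquality
  using (_≡_; _≢_; refl; sym; trans; cong; cong₂; subst; module ≡-Reasoning)

open import Data.Nat.Properties
  using (+-assoc; +-comm; +-suc; *-suc; *-comm; +-identityʳ; +-mono-≤; ≤-trans; ≤-pred;
         ≤∧≢⇒<; ≤-reflexive; ≮⇒≥; <-irrefl; <⇒≱; n<1+n; +-commutativeSemigroup)
open import Data.Nat.DivMod
  using (m≡m%n+[m/n]*n; %-distribˡ-+; m%n%n≡m%n; [m+kn]%n≡m%n; m*n%n≡0; m%n<n; m<n⇒m%n≡m; m/n*n≤m)
open import Data.Nat.ListAction using (sum)
open import Data.Parity.Base using (Parity; 0ℙ; 1ℙ) renaming (_+_ to _⊕_; _*_ to _⊗_)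
import Data.Parity.Properties as ℙ
open import Algebra.Properties.CommutativeSemigroup +-commutativeSemigroup using (x∙yz≈y∙xz)
open import Algebra.Properties.CommutativeSemigroup ℙ.+-commutativeSemigroup using (interchange)
open import Data.Fin using (Fin; toℕ)
open import Data.Fin.Properties using (pigeonhole; toℕ<n)
open import Data.List.Properties using (length-++; filter-none; filter-accept; filter-reject)
open import Data.List.Relation.Unary.Any using (here; there; index)
open import Data.List.Relation.Unary.Any.Properties using (lookup-index)
open import Data.List.Relation.Unary.AllPairs using (_∷_)
import Data.List.Relation.Unary.All as All
open import Data.List.Membership.Propositional.Properties using (∈-++⁺ˡ; ∈-++⁺ʳ)
open import Data.List.Membership.DecPropositional _≟_ using (_∈?_)
open import Data.Sum using (_⊎_; inj₁; inj₂; [_,_])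
open import Relation.Unary using (Pred; Decidable)
open import Function using (_∘_)

open ≡-Reasoning


[m%d+n]%d≡[m+n]%d : ∀ m n d .{{_ : NonZero d}} → (m % d + n) % d ≡ (m + n) % d
[m%d+n]%d≡[m+n]%d m n d = begin
  (m % d + n) % d            ≡⟨ %-distribˡ-+ (m % d) n d ⟩
  (m % d % d + n % d) % d    ≡⟨ cong (λ x → (x + n % d) % d) (m%n%n≡m%n m d) ⟩
  (m % d + n % d) % d        ≡⟨ %-distribˡ-+ m n d ⟨
  (m + n) % d                ∎

[1+m]%[1+n]≡0 : ∀ {n} m → m % suc n ≡ n → suc m % suc n ≡ 0
[1+m]%[1+n]≡0 {n} m m%≡n = begin
  suc m % suc n                                 ≡⟨ cong (λ x → suc x % suc n) (m≡m%n+[m/n]*n m (suc n)) ⟩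
  suc (m % suc n + m / suc n * suc n) % suc n   ≡⟨ cong (λ x → suc (x + m / suc n * suc n) % suc n) m%≡n ⟩
  suc (m / suc n) * suc n % suc n               ≡⟨ m*n%n≡0 (suc (m / suc n)) (suc n) ⟩
  0                                             ∎

[1+m]%[1+n]≡1+m%[1+n] : ∀ {n} m → m % suc n ≢ n → suc m % suc n ≡ suc (m % suc n)
[1+m]%[1+n]≡1+m%[1+n] {n} m m%≢n = begin
  suc m % suc n                                 ≡⟨ cong (λ x → suc x % suc n) (m≡m%n+[m/n]*n m (suc n)) ⟩
  (suc (m % suc n) + m / suc n * suc n) % suc n ≡⟨ [m+kn]%n≡m%n (suc (m % suc n)) (m / suc n) (suc n) ⟩
  suc (m % suc n) % suc n                       ≡⟨ m<n⇒m%n≡m (s≤s (≤∧≢⇒< (≤-pred (m%n<n m (suc n))) m%≢n)) ⟩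
  suc (m % suc n)                               ∎


-- Adding m * n undoes the shift by m, since m + m * n is a multiple of suc n.
clock-retraction : ∀ {n t} m → t < suc n → (clock (suc n) t m + m * n) % suc n ≡ t
clock-retraction {n} {t} m t<p = begin
  ((m + t) % suc n + m * n) % suc n   ≡⟨ [m%d+n]%d≡[m+n]%d (m + t) (m * n) (suc n) ⟩
  (m + t + m * n) % suc n             ≡⟨ cong (_% suc n) (trans (+-assoc m t (m * n)) (x∙yz≈y∙xz m t (m * n))) ⟩
  (t + (m + m * n)) % suc n           ≡⟨ cong (λ x → (t + x) % suc n) (*-suc m n) ⟨
  (t + m * suc n) % suc n             ≡⟨ [m+kn]%n≡m%n t m (suc n) ⟩
  t % suc n                           ≡⟨ m<n⇒m%n≡m t<p ⟩
  t                                   ∎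

clock-injective : ∀ {n a b} m → a < suc n → b < suc n →
                  clock (suc n) a m ≡ clock (suc n) b m → a ≡ b
clock-injective {n} m a<p b<p eq = begin
  _  ≡⟨ clock-retraction m a<p ⟨
  _  ≡⟨ cong (λ x → (x + m * n) % suc n) eq ⟩
  _  ≡⟨ clock-retraction m b<p ⟩
  _  ∎

wrapTime : ℕ → ℕ → ℕ
wrapTime n c = n + c * n

clock-wrapTime : ∀ n c → clock (suc n) c (wrapTime n c) ≡ n
clock-wrapTime n c = begin
  (n + c * n + c) % suc n   ≡⟨ cong (_% suc n) (trans (+-assoc n (c * n) c) (cong (n +_) (+-comm (c * n) c))) ⟩
  (n + (c + c * n)) % suc n ≡⟨ cong (λ x → (n + x) % suc n) (*-suc c n) ⟨
  (n + c * suc n) % suc n   ≡⟨ [m+kn]%n≡m%n n c (suc n) ⟩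
  n % suc n                 ≡⟨ m<n⇒m%n≡m (n<1+n n) ⟩
  n                         ∎


clockTotal : ℕ → List ℕ → ℕ → ℕ
clockTotal n ts m = sum (map (λ t → clock (suc n) t m) ts)

wraps : ℕ → List ℕ → ℕ → ℕ
wraps n ts m = length (filter (λ t → clock (suc n) t m ≟ n) ts)

1+[m+[n+o]]≡m+n+[1+o] : ∀ m n o → suc (m + (n + o)) ≡ m + n + suc o
1+[m+[n+o]]≡m+n+[1+o] m n o = sym (trans (+-suc (m + n) o) (cong suc (+-assoc m n o)))

clockTotal-suc : ∀ n ts m → clockTotal n ts (suc m) + wraps n ts m * suc n ≡ clockTotal n ts m + length ts
clockTotal-suc n [] m = refl
clockTotal-suc n (t ∷ ts) m with clock (suc n) t m ≟ n
... | yes shows-n = begin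
  c′ + T′ + wraps n (t ∷ ts) m * suc n   ≡⟨ cong₂ (λ x y → x + T′ + y * suc n) ([1+m]%[1+n]≡0 (m + t) shows-n) (cong length (filter-accept P? shows-n)) ⟩
  T′ + (suc n + W * suc n)               ≡⟨ x∙yz≈y∙xz T′ (suc n) (W * suc n) ⟩
  suc n + (T′ + W * suc n)               ≡⟨ cong₂ _+_ (cong suc (sym shows-n)) (clockTotal-suc n ts m) ⟩
  suc (c + (T + length ts))              ≡⟨ 1+[m+[n+o]]≡m+n+[1+o] c T (length ts) ⟩
  c + T + suc (length ts)                ∎
  where
  P? = λ t → clock (suc n) t m ≟ n
  c = clock (suc n) t m
  c′ = clock (suc n) t (suc m)
  T = clockTotal n ts m
  T′ = clockTotal n ts (suc m)
  W = wraps n ts m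
... | no ¬shows-n = begin
  c′ + T′ + wraps n (t ∷ ts) m * suc n   ≡⟨ cong₂ (λ x y → x + T′ + y * suc n) ([1+m]%[1+n]≡1+m%[1+n] (m + t) ¬shows-n) (cong length (filter-reject P? ¬shows-n)) ⟩
  suc c + T′ + W * suc n                 ≡⟨ +-assoc (suc c) T′ (W * suc n) ⟩
  suc (c + (T′ + W * suc n))             ≡⟨ cong (λ x → suc (c + x)) (clockTotal-suc n ts m) ⟩
  suc (c + (T + length ts))              ≡⟨ 1+[m+[n+o]]≡m+n+[1+o] c T (length ts) ⟩
  c + T + suc (length ts)                ∎
  where
  P? = λ t → clock (suc n) t m ≟ n
  c = clock (suc n) t m
  c′ = clock (suc n) t (suc m)
  T = clockTotal n ts m
  T′ = clockTotal n ts (suc m)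
  W = wraps n ts m


parity-%2 : ∀ k → parity (k % 2) ≡ parity k
parity-%2 k = sym (begin
  parity k                                   ≡⟨ cong parity (m≡m%n+[m/n]*n k 2) ⟩
  parity (k % 2 + k / 2 * 2)                 ≡⟨ ℙ.+-homo-+ (k % 2) (k / 2 * 2) ⟩
  parity (k % 2) ⊕ parity (k / 2 * 2)        ≡⟨ cong (parity (k % 2) ⊕_) (trans (ℙ.*-homo-* (k / 2) 2) (ℙ.*-zeroʳ _)) ⟩
  parity (k % 2) ⊕ 0ℙ                        ≡⟨ ℙ.+-identityʳ _ ⟩
  parity (k % 2)                             ∎)

%2≡1⇒parity≡1ℙ : ∀ k → k % 2 ≡ 1 → parity k ≡ 1ℙ
%2≡1⇒parity≡1ℙ k k%2≡1 = trans (sym (parity-%2 k)) (cong parity k%2≡1)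

⊕-cancel-common : ∀ a x y → (a ⊕ x) ⊕ (a ⊕ y) ≡ x ⊕ y
⊕-cancel-common a x y = begin
  (a ⊕ x) ⊕ (a ⊕ y)   ≡⟨ interchange a x a y ⟩
  (a ⊕ a) ⊕ (x ⊕ y)   ≡⟨ cong (_⊕ (x ⊕ y)) (ℙ.p+p≡0ℙ a) ⟩
  x ⊕ y               ∎

-- Each wrap-around subtracts the odd number suc n from the total.
parity-clockTotal-suc : ∀ n ts m → parity (suc n) ≡ 1ℙ →
  parity (clockTotal n ts (suc m)) ⊕ parity (wraps n ts m) ≡ parity (clockTotal n ts m) ⊕ parity (length ts)
parity-clockTotal-suc n ts m odd = begin
  parity T′ ⊕ parity W                     ≡⟨ cong (parity T′ ⊕_) (ℙ.*-identityʳ (parity W)) ⟨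
  parity T′ ⊕ (parity W ⊗ 1ℙ)              ≡⟨ cong (λ x → parity T′ ⊕ (parity W ⊗ x)) odd ⟨
  parity T′ ⊕ (parity W ⊗ parity (suc n))  ≡⟨ cong (parity T′ ⊕_) (ℙ.*-homo-* W (suc n)) ⟨
  parity T′ ⊕ parity (W * suc n)           ≡⟨ ℙ.+-homo-+ T′ (W * suc n) ⟨
  parity (T′ + W * suc n)                ≡⟨ cong parity (clockTotal-suc n ts m) ⟩
  parity (clockTotal n ts m + length ts) ≡⟨ ℙ.+-homo-+ (clockTotal n ts m) (length ts) ⟩
  parity (clockTotal n ts m) ⊕ parity (length ts) ∎
  where
  T′ = clockTotal n ts (suc m)
  W = wraps n ts m

wraps-parity-difference : ∀ n s t → parity (suc n) ≡ 1ℙ →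
  (∀ m → clockSum (suc n) s m ≡ clockSum (suc n) t m) →
  ∀ m → parity (wraps n s m) ⊕ parity (wraps n t m) ≡ parity (length s) ⊕ parity (length t)
wraps-parity-difference n s t odd same m = begin
  parity (wraps n s m) ⊕ parity (wraps n t m)       ≡⟨ ⊕-cancel-common (Πs (suc m)) _ _ ⟨
  (Πs (suc m) ⊕ parity (wraps n s m)) ⊕ (Πs (suc m) ⊕ parity (wraps n t m))
    ≡⟨ cong₂ _⊕_ (parity-clockTotal-suc n s m odd)
                 (trans (cong (_⊕ parity (wraps n t m)) (same-parity (suc m))) (parity-clockTotal-suc n t m odd)) ⟩
  (Πs m ⊕ parity (length s)) ⊕ (Πt m ⊕ parity (length t))
    ≡⟨ cong (λ x → (Πs m ⊕ parity (length s)) ⊕ (x ⊕ parity (length t))) (same-parity m) ⟨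
  (Πs m ⊕ parity (length s)) ⊕ (Πs m ⊕ parity (length t)) ≡⟨ ⊕-cancel-common (Πs m) _ _ ⟩
  parity (length s) ⊕ parity (length t)             ∎
  where
  Πs Πt : ℕ → Parity
  Πs m = parity (clockTotal n s m)
  Πt m = parity (clockTotal n t m)
  same-parity : ∀ m → Πs m ≡ Πt m
  same-parity m = trans (sym (parity-%2 (clockTotal n s m))) (trans (cong parity (same m)) (parity-%2 (clockTotal n t m)))


χ : ∀ {a} {A : Set a} → Dec A → Parity
χ (yes _) = 1ℙ
χ (no _)  = 0ℙ

χ-⊕≡0ℙ : ∀ {a b} {A : Set a} {B : Set b} (A? : Dec A) (B? : Dec B) → χ A? ⊕ χ B? ≡ 0ℙ → A → B
χ-⊕≡0ℙ (yes _) (yes b) _  _ = b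
χ-⊕≡0ℙ (yes _) (no _)  () _
χ-⊕≡0ℙ (no ¬a) _       _  a = contradiction a ¬a

χ-⊕≡1ℙ : ∀ {a b} {A : Set a} {B : Set b} (A? : Dec A) (B? : Dec B) → χ A? ⊕ χ B? ≡ 1ℙ → A ⊎ B
χ-⊕≡1ℙ (yes a) _       _  = inj₁ a
χ-⊕≡1ℙ (no _)  (yes b) _  = inj₂ b
χ-⊕≡1ℙ (no _)  (no _)  ()

module _ {a ℓ} {A : Set a} {P : Pred A ℓ} (P? : Decidable P) where

  length-filter-none : ∀ {xs} → (∀ {y} → y ∈ xs → ¬ P y) → length (filter P? xs) ≡ 0
  length-filter-none ¬P = cong length (filter-none P? (All.tabulate ¬P))

  length-filter-single : ∀ {x xs} → Unique xs → x ∈ xs → P x → (∀ {y} → y ∈ xs → P y → y ≡ x) →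
                         length (filter P? xs) ≡ 1
  length-filter-single (y∉ys ∷ _) (here refl) Px only-x =
    trans (cong length (filter-accept P? Px))
          (cong suc (length-filter-none λ z∈ys Pz → All.lookup y∉ys z∈ys (sym (only-x (there z∈ys) Pz))))
  length-filter-single (y∉ys ∷ ys!) (there x∈ys) Px only-x =
    trans (cong length (filter-reject P? λ Py → All.lookup y∉ys x∈ys (only-x (here refl) Py)))
          (length-filter-single ys! x∈ys Px (only-x ∘ there))

  parity-length-filter : ∀ {x xs} → Unique xs → P x → (∀ {y} → y ∈ xs → P y → y ≡ x) →
                         (x∈? : Dec (x ∈ xs)) → parity (length (filter P? xs)) ≡ χ x∈?
  parity-length-filter xs! Px only-x (yes x∈xs) = cong parity (length-filter-single xs! x∈xs Px only-x)
  parity-length-filter xs! Px only-x (no x∉xs)  =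
    cong parity (length-filter-none λ y∈xs Py → x∉xs (subst (_∈ _) (only-x y∈xs Py) y∈xs))

parity-wraps-wrapTime : ∀ n {ts} c → All (_< suc n) ts → Unique ts → c < suc n →
                         parity (wraps n ts (wrapTime n c)) ≡ χ (c ∈? ts)
parity-wraps-wrapTime n {ts} c ts<p ts! c<p =
  parity-length-filter (λ t → clock (suc n) t m ≟ n) ts! (clock-wrapTime n c) only-c (c ∈? ts)
  where
  m = wrapTime n c
  only-c : ∀ {y} → y ∈ ts → clock (suc n) y m ≡ n → y ≡ c
  only-c y∈ts shows-n = clock-injective m (All.lookup ts<p y∈ts) c<p (trans shows-n (sym (clock-wrapTime n c)))

membership-parity : ∀ n {s t} → parity (suc n) ≡ 1ℙ →
  All (_< suc n) s → Unique s → All (_< suc n) t → Unique t →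
  (∀ m → clockSum (suc n) s m ≡ clockSum (suc n) t m) →
  ∀ c → c < suc n → χ (c ∈? s) ⊕ χ (c ∈? t) ≡ parity (length s) ⊕ parity (length t)
membership-parity n {s} {t} odd s<p s! t<p t! same c c<p = begin
  χ (c ∈? s) ⊕ χ (c ∈? t)
    ≡⟨ cong₂ _⊕_ (parity-wraps-wrapTime n c s<p s! c<p) (parity-wraps-wrapTime n c t<p t! c<p) ⟨
  parity (wraps n s (wrapTime n c)) ⊕ parity (wraps n t (wrapTime n c))
    ≡⟨ wraps-parity-difference n s t odd same (wrapTime n c) ⟩
  parity (length s) ⊕ parity (length t)
    ∎

agree-or-cover : ∀ {k} {s t : List ℕ} δ → All (_< k) s → All (_< k) t →
                 (∀ c → c < k → χ (c ∈? s) ⊕ χ (c ∈? t) ≡ δ) →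
                 (∀ x → (x ∈ s → x ∈ t) × (x ∈ t → x ∈ s)) ⊎ (∀ c → c < k → c ∈ s ⊎ c ∈ t)
agree-or-cover {s = s} {t} 0ℙ s<k t<k δ≡ = inj₁ λ x →
    (λ x∈s → χ-⊕≡0ℙ (x ∈? s) (x ∈? t) (δ≡ x (All.lookup s<k x∈s)) x∈s)
  , (λ x∈t → χ-⊕≡0ℙ (x ∈? t) (x ∈? s) (trans (ℙ.+-comm (χ (x ∈? t)) (χ (x ∈? s))) (δ≡ x (All.lookup t<k x∈t))) x∈t)
agree-or-cover {s = s} {t} 1ℙ _ _ δ≡ = inj₂ λ c c<k → χ-⊕≡1ℙ (c ∈? s) (c ∈? t) (δ≡ c c<k)


-- Pigeonhole: the positions of 0, …, k - 1 in xs are pairwise distinct.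
cover⇒≤length : ∀ {k} (xs : List ℕ) → (∀ c → c < k → c ∈ xs) → k ≤ length xs
cover⇒≤length {k} xs cover = ≮⇒≥ λ |xs|<k → no-collision (pigeonhole |xs|<k position)
  where
  covered : (i : Fin k) → toℕ i ∈ xs
  covered i = cover (toℕ i) (toℕ<n i)
  position : Fin k → Fin (length xs)
  position i = index (covered i)
  no-collision : ¬ ∃₂ λ i j → toℕ i < toℕ j × position i ≡ position j
  no-collision (i , j , i<j , same-position) = <-irrefl (begin
    toℕ i                     ≡⟨ lookup-index (covered i) ⟩
    lookup xs (position i)    ≡⟨ cong (lookup xs) same-position ⟩
    lookup xs (position j)    ≡⟨ lookup-index (covered j) ⟨
    toℕ j                     ∎) i<j

n/2+n/2≤n : ∀ n → n / 2 + n / 2 ≤ n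
n/2+n/2≤n n = ≤-trans (≤-reflexive (trans (cong (n / 2 +_) (sym (+-identityʳ (n / 2)))) (*-comm 2 (n / 2))))
                       (m/n*n≤m n 2)

mainTheorem6 : (p : ℕ) → .{{_ : NonZero p}} → OneMod4Prime p →
    (s t : List ℕ) →
    All (λ x → x < p) s → Unique s →
    All (λ x → x < p) t → Unique t →
    ¬ (∀ x → (x ∈ s → x ∈ t) × (x ∈ t → x ∈ s)) →
    length s ≤ (p ∸ 1) / 2 → length t ≤ (p ∸ 1) / 2 →
    ¬ (∀ m → clockSum p s m ≡ clockSum p t m)
mainTheorem6 (suc n) (_ , p%2≡1 , _) s t s<p s! t<p t! s≉t |s|≤ |t|≤ same
  with agree-or-cover _ s<p t<p (membership-parity n (%2≡1⇒parity≡1ℙ (suc n) p%2≡1) s<p s! t<p t! same)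
... | inj₁ s≈t   = s≉t s≈t
... | inj₂ cover = <⇒≱ short (cover⇒≤length (s ++ t) λ c c<p → [ ∈-++⁺ˡ , ∈-++⁺ʳ s ] (cover c c<p))
  where
  short : length (s ++ t) < suc n
  short = s≤s (≤-trans (≤-reflexive (length-++ s)) (≤-trans (+-mono-≤ |s|≤ |t|≤) (n/2+n/2≤n n)))
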